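{- Let $\mathfrak{A}$ be a complete Boolean algebra with operators. If every formula of the logic $\mathbf{L}$ is valid in $\mathfrak{A}$, then the formula $F := \Box p\rightarrow \Box^2 p$ is valid in $\mathfrak{A}$.
   Context: A Boolean algebra with operators (BAO) here is a structure $\mathfrak{A}=\langle A,\wedge,-,0,\Diamond\rangle$ where $\langle A,\wedge,-,0\rangle$ is a Boolean algebra and $\Diamond$ is a unary operation with $\Diamond 0=0$ and $\Diamond(a\vee b)=\Diamond a\vee\Diamond b$; $\Box a:=-\Diamond - a$. It is complete if the underlying Boolean algebra is complete (every subset has a supremum). A modal formula is valid in $\mathfrak{A}$ if it evaluates to the top element $1$ under every assignment of elements of $\mathfrak{A}$ to its propositional variables (with $\wedge,\neg,\rightarrow,\vee,\Diamond,\Box$ interpreted in the obvious way). Define the formulas $A_i:=\Box (q_i\rightarrow r)$, $B_i:=\Box (r\rightarrow \Diamond q_i)$ for $i=1,2$, $C_1:=\Box \neg (q_1\wedge q_2)$, $A:= \big(r\wedge\Box p\wedge\neg \Box^2 p\wedge A_1\wedge A_2\wedge B_1\wedge B_2\wedge C_1\big)\rightarrow \Diamond\big(r\wedge\Box(r\rightarrow q_1\vee q_2)\big)$, $B:=\Box(p\rightarrow q)\rightarrow (\Box p\rightarrow \Box q)$, $C:=\Box p\rightarrow p$, $D:=(p\wedge \Diamond^2 q)\rightarrow (\Diamond q\vee \Diamond^2(q\wedge\Diamond p))$, $E:=(\Box p\wedge \neg \Box^2 p)\rightarrow \Diamond (\Box^2 p\wedge \neg\Box^3 p)$. $\mathbf{L}$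 is the smallest set of modal formulas containing all propositional tautologies and $A,B,C,D,E$, and closed under modus ponens, uniform substitution and necessitation (from $\varphi$ infer $\Box\varphi$). -}

module Defs where

open import Level using (Level; _⊔_) renaming (suc to lsuc)
open import Data.Nat using (ℕ)
open import Data.Bool using (Bool; true; false; not) renaming (_∧_ to _∧ᵇ_; _∨_ to _∨ᵇ_)
open import Data.Product using (Σ; _×_; _,_)
open import Data.Unit using () renaming (⊤ to Unit)
open import Data.Empty using () renaming (⊥ to Empty)
open import Relation.Binary.PropositionalEquality using (_≡_)
open import Algebra.Lattice.Bundles using (BooleanAlgebra)

record BAO (c ℓ : Level) : Set (lsuc (c ⊔ ℓ)) where
  field
    boolAlg : BooleanAlgebra c ℓ
  open BooleanAlgebra boolAlg public
  field
    ◇         : Carrier → Carrier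
    ◇-cong    : ∀ {a b} → a ≈ b → ◇ a ≈ ◇ b
    ◇-⊥       : ◇ ⊥ ≈ ⊥
    ◇-∨       : ∀ a b → ◇ (a ∨ b) ≈ (◇ a ∨ ◇ b)

  □ : Carrier → Carrier
  □ a = ¬ ◇ (¬ a)

  _≤_ : Carrier → Carrier → Set ℓ
  a ≤ b = (a ∧ b) ≈ a

IsSup : ∀ {c ℓ ℓ'} (𝔄 : BAO c ℓ) → (BAO.Carrier 𝔄 → Set ℓ') → BAO.Carrier 𝔄 → Set (c ⊔ ℓ ⊔ ℓ')
IsSup 𝔄 S s =
  (∀ x → S x → x ≤ s) × (∀ u → (∀ x → S x → x ≤ u) → s ≤ u)
  where open BAO 𝔄

Complete : ∀ {c ℓ} → BAO c ℓ → Set (lsuc (c ⊔ ℓ))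
Complete {c} {ℓ} 𝔄 = (S : BAO.Carrier 𝔄 → Set (c ⊔ ℓ)) → Σ (BAO.Carrier 𝔄) (IsSup 𝔄 S)

infixr 4 _⇒_
infixr 5 _∨ᶠ_
infixr 6 _∧ᶠ_

data Fm : Set where
  var   : ℕ → Fm
  ¬ᶠ_   : Fm → Fm
  _∧ᶠ_  : Fm → Fm → Fm
  _∨ᶠ_  : Fm → Fm → Fm
  _⇒_   : Fm → Fm → Fm
  ◇ᶠ_   : Fm → Fm
  □ᶠ_   : Fm → Fm

eval : ∀ {c ℓ} (𝔄 : BAO c ℓ) → Fm → (ℕ → BAO.Carrier 𝔄) → BAO.Carrier 𝔄
eval 𝔄 φ v = go φ
  where
  open BAO 𝔄
  go : Fm → Carrier
  go (var n)   = v n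
  go (¬ᶠ φ)    = ¬ go φ
  go (φ ∧ᶠ ψ)  = go φ ∧ go ψ
  go (φ ∨ᶠ ψ)  = go φ ∨ go ψ
  go (φ ⇒ ψ)   = (¬ go φ) ∨ go ψ
  go (◇ᶠ φ)    = ◇ (go φ)
  go (□ᶠ φ)    = □ (go φ)

Valid : ∀ {c ℓ} → BAO c ℓ → Fm → Set (c ⊔ ℓ)
Valid 𝔄 φ = ∀ (v : ℕ → BAO.Carrier 𝔄) → eval 𝔄 φ v ≈ ⊤
  where open BAO 𝔄

-- Propositional tautologies: modal-free formulas true under every
-- Boolean valuation (their substitution instances are obtained via the
-- closure of L under uniform substitution).

ModalFree : Fm → Set
ModalFree (var _)  = Unit
ModalFree (¬ᶠ φ)   = ModalFree φ
ModalFree (φ ∧ᶠ ψ) = ModalFree φ × ModalFree ψ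
ModalFree (φ ∨ᶠ ψ) = ModalFree φ × ModalFree ψ
ModalFree (φ ⇒ ψ)  = ModalFree φ × ModalFree ψ
ModalFree (◇ᶠ _)   = Empty
ModalFree (□ᶠ _)   = Empty

-- Boolean evaluation (modal cases are irrelevant for modal-free formulas)
evalB : (ℕ → Bool) → Fm → Bool
evalB v (var n)  = v n
evalB v (¬ᶠ φ)   = not (evalB v φ)
evalB v (φ ∧ᶠ ψ) = evalB v φ ∧ᵇ evalB v ψ
evalB v (φ ∨ᶠ ψ) = evalB v φ ∨ᵇ evalB v ψ
evalB v (φ ⇒ ψ)  = not (evalB v φ) ∨ᵇ evalB v ψ
evalB v (◇ᶠ φ)   = false
evalB v (□ᶠ φ)   = false

Tautology : Fm → Set
Tautology φ = ModalFree φ × (∀ (v : ℕ → Bool) → evalB v φ ≡ true)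

subst : (ℕ → Fm) → Fm → Fm
subst σ (var n)  = σ n
subst σ (¬ᶠ φ)   = ¬ᶠ subst σ φ
subst σ (φ ∧ᶠ ψ) = subst σ φ ∧ᶠ subst σ ψ
subst σ (φ ∨ᶠ ψ) = subst σ φ ∨ᶠ subst σ ψ
subst σ (φ ⇒ ψ)  = subst σ φ ⇒ subst σ ψ
subst σ (◇ᶠ φ)   = ◇ᶠ subst σ φ
subst σ (□ᶠ φ)   = □ᶠ subst σ φ

p q r q₁ q₂ : Fm
p  = var 0
q  = var 1
r  = var 2
q₁ = var 3
q₂ = var 4

Ax-A₁ Ax-A₂ Ax-B₁ Ax-B₂ Ax-C₁ : Fm
Ax-A₁ = □ᶠ (q₁ ⇒ r)
Ax-A₂ = □ᶠ (q₂ ⇒ r)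
Ax-B₁ = □ᶠ (r ⇒ ◇ᶠ q₁)
Ax-B₂ = □ᶠ (r ⇒ ◇ᶠ q₂)
Ax-C₁ = □ᶠ (¬ᶠ (q₁ ∧ᶠ q₂))

Ax-A Ax-B Ax-C Ax-D Ax-E : Fm
Ax-A = (r ∧ᶠ □ᶠ p ∧ᶠ ¬ᶠ (□ᶠ □ᶠ p) ∧ᶠ Ax-A₁ ∧ᶠ Ax-A₂ ∧ᶠ Ax-B₁ ∧ᶠ Ax-B₂ ∧ᶠ Ax-C₁)
       ⇒ ◇ᶠ (r ∧ᶠ □ᶠ (r ⇒ (q₁ ∨ᶠ q₂)))
Ax-B = □ᶠ (p ⇒ q) ⇒ (□ᶠ p ⇒ □ᶠ q)
Ax-C = □ᶠ p ⇒ p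
Ax-D = (p ∧ᶠ ◇ᶠ ◇ᶠ q) ⇒ (◇ᶠ q ∨ᶠ ◇ᶠ ◇ᶠ (q ∧ᶠ ◇ᶠ p))
Ax-E = (□ᶠ p ∧ᶠ ¬ᶠ (□ᶠ □ᶠ p)) ⇒ ◇ᶠ (□ᶠ □ᶠ p ∧ᶠ ¬ᶠ (□ᶠ □ᶠ □ᶠ p))

Ax-F : Fm
Ax-F = □ᶠ p ⇒ □ᶠ □ᶠ p

data L : Fm → Set where
  taut : ∀ {φ} → Tautology φ → L φ
  axA  : L Ax-A
  axB  : L Ax-B
  axC  : L Ax-C
  axD  : L Ax-D
  axE  : L Ax-E
  mp   : ∀ {φ ψ} → L (φ ⇒ ψ) → L φ → L ψ
  usub : ∀ {φ} (σ : ℕ → Fm) → L φ → L (subst σ φ)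
  nec  : ∀ {φ} → L φ → L (□ᶠ φ)

-- Fix a and let Lₖ = □ᵏ⁺¹a ∧ ¬□ᵏ⁺²a; it suffices that L₀ = ⊥. By C the powers
-- □ⁿa decrease, so the Lₖ are pairwise disjoint; E gives Lₖ ≤ ◇Lₖ₊₁, which D
-- upgrades to Lₖ ≤ ◇Lⱼ for all j > k. By completeness let r = ⋁ₖ Lₖ and let
-- s₀, s₁, s₂ be the joins of the Lₖ with k ≡ 0, 1, 2 (mod 3). Below L₀ the
-- antecedent of A holds for p = a, q₁ = s₀, q₂ = s₁, whereas its consequent
-- ◇(r ∧ □(r → s₀ ∨ s₁)) is ⊥ because r ≤ ◇s₂ and s₂ is disjoint from r → s₀ ∨ s₁.
module Submission where

open import Defs
open import Level using (Level; Lift; lift)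
open import Data.Nat as ℕ using (ℕ; zero; suc; _+_; _*_; _%_; s≤s; _≤′_; ≤′-refl; ≤′-step; _<′_)
import Data.Nat.Properties as ℕₚ
open import Data.Nat.DivMod using ([m+kn]%n≡m%n)
open import Data.Product using (Σ; _,_; proj₁; proj₂)
open import Relation.Nullary using (contradiction)
open import Relation.Binary.Definitions using (tri<; tri≈; tri>)
open import Relation.Binary.PropositionalEquality as ≡ using (_≡_; _≢_)
open import Algebra.Lattice.Bundles using (BooleanAlgebra)
import Algebra.Lattice.Properties.BooleanAlgebra as BooleanAlgebraProperties
import Algebra.Lattice.Properties.Lattice as LatticeProperties
import Relation.Binary.Lattice as OrderLattice
import Relation.Binary.Lattice.Properties.JoinSemilattice as JoinSemilatticeProperties
import Relation.Binary.Lattice.Properties.MeetSemilattice as MeetSemilatticeProperties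
import Relation.Binary.Reasoning.Setoid as SetoidReasoning

module BooleanOrder {c ℓ} (B : BooleanAlgebra c ℓ) where
  open BooleanAlgebra B
  open BooleanAlgebraProperties B using (¬-involutive; ∧-identityʳ; ∧-zeroˡ; deMorgan₂; ¬⊤≈⊥)
  open SetoidReasoning setoid

  orderLattice : OrderLattice.Lattice c ℓ ℓ
  orderLattice = record
    { isLattice = LatticeProperties.∨-∧-isOrderTheoreticLattice lattice }

  open OrderLattice.Lattice orderLattice public
    using (_≤_; x≤x∨y; ∨-least; x∧y≤x; x∧y≤y; ∧-greatest)
    renaming (refl to ≤-refl; trans to ≤-trans; antisym to ≤-antisym; reflexive to ≤-reflexive)
  open JoinSemilatticeProperties (OrderLattice.Lattice.joinSemilattice orderLattice) public
    using (x≤y⇒x∨y≈y; ∨-monotonic)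
  open MeetSemilatticeProperties (OrderLattice.Lattice.meetSemilattice orderLattice) public
    using (∧-monotonic)

  ⊥-minimum : ∀ {x} → ⊥ ≤ x
  ⊥-minimum {x} = sym (∧-zeroˡ x)

  ⊤-maximum : ∀ {x} → x ≤ ⊤
  ⊤-maximum {x} = sym (∧-identityʳ x)

  ≈⊤⇒≥ : ∀ {x y} → x ≈ ⊤ → y ≤ x
  ≈⊤⇒≥ x≈⊤ = ≤-trans ⊤-maximum (≤-reflexive (sym x≈⊤))

  ∧≤⊥⇒≤¬ : ∀ {x y} → x ∧ y ≤ ⊥ → x ≤ ¬ y
  ∧≤⊥⇒≤¬ {x} {y} x∧y≤⊥ =
    ≤-trans (≤-reflexive split) (∨-least (≤-trans x∧y≤⊥ ⊥-minimum) (x∧y≤y x (¬ y)))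
    where
    split : x ≈ (x ∧ y) ∨ (x ∧ ¬ y)
    split = begin
      x                    ≈⟨ sym (∧-identityʳ x) ⟩
      x ∧ ⊤                ≈⟨ ∧-congˡ (sym (∨-complementʳ y)) ⟩
      x ∧ (y ∨ ¬ y)        ≈⟨ ∧-distribˡ-∨ x y (¬ y) ⟩
      (x ∧ y) ∨ (x ∧ ¬ y)  ∎

  ≤¬⇒∧≤⊥ : ∀ {x y} → x ≤ ¬ y → x ∧ y ≤ ⊥
  ≤¬⇒∧≤⊥ {y = y} x≤¬y =
    ≤-trans (∧-monotonic x≤¬y ≤-refl) (≤-reflexive (∧-complementˡ y))

  ≤¬-swap : ∀ {x y} → x ≤ ¬ y → y ≤ ¬ x
  ≤¬-swap {x} {y} x≤¬y = ∧≤⊥⇒≤¬ (≤-trans (≤-reflexive (∧-comm y x)) (≤¬⇒∧≤⊥ x≤¬y))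

  ¬-antitone : ∀ {x y} → x ≤ y → ¬ y ≤ ¬ x
  ¬-antitone {y = y} x≤y = ≤¬-swap (≤-trans x≤y (≤-reflexive (sym (¬-involutive y))))

  ∧¬≤⊥⇒≤ : ∀ {x y} → x ∧ ¬ y ≤ ⊥ → x ≤ y
  ∧¬≤⊥⇒≤ {y = y} x∧¬y≤⊥ = ≤-trans (∧≤⊥⇒≤¬ x∧¬y≤⊥) (≤-reflexive (¬-involutive y))

  ≤⇒¬∨≈⊤ : ∀ {x y} → x ≤ y → ¬ x ∨ y ≈ ⊤
  ≤⇒¬∨≈⊤ {x} x≤y = ≤-antisym ⊤-maximum
    (≤-trans (≤-reflexive (sym (∨-complementˡ x))) (∨-monotonic ≤-refl x≤y))

  ¬∨≈⊤⇒≤ : ∀ {x y} → ¬ x ∨ y ≈ ⊤ → x ≤ y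
  ¬∨≈⊤⇒≤ {x} {y} ¬x∨y≈⊤ = ∧¬≤⊥⇒≤ (≤-reflexive (begin
    x ∧ ¬ y      ≈⟨ ∧-congʳ (sym (¬-involutive x)) ⟩
    ¬ ¬ x ∧ ¬ y  ≈⟨ sym (deMorgan₂ (¬ x) y) ⟩
    ¬ (¬ x ∨ y)  ≈⟨ ¬-cong ¬x∨y≈⊤ ⟩
    ¬ ⊤          ≈⟨ ¬⊤≈⊥ ⟩
    ⊥            ∎))

module ModalOrder {c ℓ} (𝔄 : BAO c ℓ) where
  open BAO 𝔄 hiding (_≤_)
  open BooleanAlgebraProperties boolAlg using (¬-involutive; ¬⊥≈⊤; ¬⊤≈⊥)
  open BooleanOrder boolAlg public
  open SetoidReasoning setoid

  ◇-monotonic : ∀ {x y} → x ≤ y → ◇ x ≤ ◇ y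
  ◇-monotonic {x} {y} x≤y = ≤-trans (x≤x∨y (◇ x) (◇ y)) (≤-reflexive (begin
    ◇ x ∨ ◇ y  ≈⟨ ◇-∨ x y ⟨
    ◇ (x ∨ y)  ≈⟨ ◇-cong (x≤y⇒x∨y≈y x≤y) ⟩
    ◇ y        ∎))

  ◇-strict : ∀ {x} → x ≤ ⊥ → ◇ x ≤ ⊥
  ◇-strict x≤⊥ = ≤-trans (◇-monotonic x≤⊥) (≤-reflexive ◇-⊥)

  □-necessitation : ∀ {x} → x ≈ ⊤ → □ x ≈ ⊤
  □-necessitation {x} x≈⊤ = begin
    ¬ ◇ (¬ x)  ≈⟨ ¬-cong (◇-cong (¬-cong x≈⊤)) ⟩
    ¬ ◇ (¬ ⊤)  ≈⟨ ¬-cong (◇-cong ¬⊤≈⊥) ⟩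
    ¬ ◇ ⊥      ≈⟨ ¬-cong ◇-⊥ ⟩
    ¬ ⊥        ≈⟨ ¬⊥≈⊤ ⟩
    ⊤          ∎

  ◇¬≤¬□ : ∀ {x} → ◇ (¬ x) ≤ ¬ □ x
  ◇¬≤¬□ {x} = ≤-reflexive (sym (¬-involutive (◇ (¬ x))))

module Suprema {c ℓ} (𝔄 : BAO c ℓ) (complete : Complete 𝔄) where
  open BAO 𝔄 hiding (_≤_)
  open ModalOrder 𝔄

  private
    Range : (ℕ → Carrier) → Carrier → Set (c Level.⊔ ℓ)
    Range f x = Lift c (Σ ℕ λ i → x ≈ f i)

  ⋁ : (ℕ → Carrier) → Carrier
  ⋁ f = proj₁ (complete (Range f))

  -- Defs orders by x ∧ y ≈ x, the lattice order used here by x ≈ x ∧ y.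
  ⋁-upper : ∀ f i → f i ≤ ⋁ f
  ⋁-upper f i = sym (proj₁ (proj₂ (complete (Range f))) (f i) (lift (i , refl)))

  ⋁-least : ∀ f {u} → (∀ i → f i ≤ u) → ⋁ f ≤ u
  ⋁-least f {u} f≤u = sym (proj₂ (proj₂ (complete (Range f))) u bound)
    where
    bound : ∀ x → Range f x → x ∧ u ≈ x
    bound x (lift (i , x≈fi)) = sym (≤-trans (≤-reflexive x≈fi) (f≤u i))

  ⋁-disjoint : ∀ f g → (∀ i j → f i ≤ ¬ g j) → ⋁ f ≤ ¬ ⋁ g
  ⋁-disjoint f g f≤¬g = ⋁-least f λ i → ≤¬-swap (⋁-least g λ j → ≤¬-swap (f≤¬g i j))

module AxiomsOfL {c ℓ} (𝔄 : BAO c ℓ) (valid-L : ∀ φ → L φ → Valid 𝔄 φ) where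
  open BAO 𝔄 hiding (_≤_)
  open ModalOrder 𝔄

  ⟨_,_,_,_,_⟩ : Carrier → Carrier → Carrier → Carrier → Carrier → ℕ → Carrier
  ⟨ p , q , r , q₁ , q₂ ⟩ 0 = p
  ⟨ p , q , r , q₁ , q₂ ⟩ 1 = q
  ⟨ p , q , r , q₁ , q₂ ⟩ 2 = r
  ⟨ p , q , r , q₁ , q₂ ⟩ 3 = q₁
  ⟨ p , q , r , q₁ , q₂ ⟩ _ = q₂

  A-law : ∀ p r q₁ q₂ →
    r ∧ □ p ∧ ¬ □ (□ p) ∧ □ (¬ q₁ ∨ r) ∧ □ (¬ q₂ ∨ r) ∧
      □ (¬ r ∨ ◇ q₁) ∧ □ (¬ r ∨ ◇ q₂) ∧ □ (¬ (q₁ ∧ q₂))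
    ≤ ◇ (r ∧ □ (¬ r ∨ (q₁ ∨ q₂)))
  A-law p r q₁ q₂ = ¬∨≈⊤⇒≤ (valid-L _ axA ⟨ p , ⊥ , r , q₁ , q₂ ⟩)

  □-deflationary : ∀ x → □ x ≤ x
  □-deflationary x = ¬∨≈⊤⇒≤ (valid-L _ axC ⟨ x , ⊥ , ⊥ , ⊥ , ⊥ ⟩)

  D-law : ∀ x y → x ∧ ◇ (◇ y) ≤ ◇ y ∨ ◇ (◇ (y ∧ ◇ x))
  D-law x y = ¬∨≈⊤⇒≤ (valid-L _ axD ⟨ x , y , ⊥ , ⊥ , ⊥ ⟩)

  E-law : ∀ x → □ x ∧ ¬ □ (□ x) ≤ ◇ (□ (□ x) ∧ ¬ □ (□ (□ x)))
  E-law x = ¬∨≈⊤⇒≤ (valid-L _ axE ⟨ x , ⊥ , ⊥ , ⊥ , ⊥ ⟩)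

  -- D turns sₖ ≤ ◇◇sⱼ into sₖ ≤ ◇sⱼ as soon as sⱼ misses ◇sₖ.
  ◇-chain : (s : ℕ → Carrier) → (∀ k → s k ≤ ◇ (s (suc k))) →
            (∀ {k j} → suc k ℕ.< j → s j ∧ ◇ (s k) ≤ ⊥) →
            ∀ {k j} → k ℕ.< j → s k ≤ ◇ (s j)
  ◇-chain s step far-apart k<j = go (ℕₚ.≤⇒≤′ k<j)
    where
    go : ∀ {k j} → k <′ j → s k ≤ ◇ (s j)
    go {k} ≤′-refl = step k
    go {k} {suc j} (≤′-step k<′j) = ≤-trans
      (∧-greatest ≤-refl (≤-trans (go k<′j) (◇-monotonic (step j))))
      (≤-trans (D-law (s k) (s (suc j)))
               (∨-least ≤-refl (≤-trans (◇-strict (◇-strict missed)) ⊥-minimum)))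
      where
      missed : s (suc j) ∧ ◇ (s k) ≤ ⊥
      missed = far-apart (s≤s (ℕₚ.≤′⇒≤ k<′j))

module Layers {c ℓ} (𝔄 : BAO c ℓ) (complete : Complete 𝔄)
              (valid-L : ∀ φ → L φ → Valid 𝔄 φ) (a : BAO.Carrier 𝔄) where
  open BAO 𝔄 hiding (_≤_)
  open BooleanAlgebraProperties boolAlg using (deMorgan₁)
  open ModalOrder 𝔄
  open Suprema 𝔄 complete
  open AxiomsOfL 𝔄 valid-L

  □^ : ℕ → Carrier
  □^ zero    = a
  □^ (suc n) = □ (□^ n)

  □^-antitone : ∀ {m n} → m ℕ.≤ n → □^ n ≤ □^ m
  □^-antitone m≤n = go (ℕₚ.≤⇒≤′ m≤n)
    where
    go : ∀ {m n} → m ≤′ n → □^ n ≤ □^ m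
    go ≤′-refl = ≤-refl
    go {n = suc n} (≤′-step m≤′n) = ≤-trans (□-deflationary (□^ n)) (go m≤′n)

  layer : ℕ → Carrier
  layer k = □^ (suc k) ∧ ¬ □^ (suc (suc k))

  layer-step : ∀ k → layer k ≤ ◇ (layer (suc k))
  layer-step k = E-law (□^ k)

  layers-disjoint : ∀ {k j} → k ℕ.< j → layer j ≤ ¬ layer k
  layers-disjoint {k} k<j = ≤-trans (x∧y≤x _ _)
    (≤-trans (□^-antitone (s≤s k<j)) (≤¬-swap (x∧y≤y (□^ (suc k)) _)))

  layers-disjoint-≢ : ∀ {k j} → k ≢ j → layer k ≤ ¬ layer j
  layers-disjoint-≢ {k} {j} k≢j with ℕₚ.<-cmp k j
  ... | tri< k<j _ _ = ≤¬-swap (layers-disjoint k<j)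
  ... | tri≈ _ k≡j _ = contradiction k≡j k≢j
  ... | tri> _ _ j<k = layers-disjoint j<k

  layer-misses-◇layer : ∀ {k j} → suc k ℕ.< j → layer j ∧ ◇ (layer k) ≤ ⊥
  layer-misses-◇layer {k} sk<j = ≤¬⇒∧≤⊥ (≤-trans (x∧y≤x _ _)
    (≤-trans (□^-antitone (s≤s sk<j))
      (≤¬-swap (≤-trans (◇-monotonic (x∧y≤y (□^ (suc k)) _)) ◇¬≤¬□))))

  layer-reaches : ∀ {k j} → k ℕ.< j → layer k ≤ ◇ (layer j)
  layer-reaches = ◇-chain layer layer-step layer-misses-◇layer

  layers : Carrier
  layers = ⋁ layer

  residue-class : ℕ → Carrier
  residue-class r = ⋁ λ i → layer (r + i * 3)

  residue-class≤layers : ∀ r → residue-class r ≤ layers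
  residue-class≤layers r = ⋁-least _ λ i → ⋁-upper layer (r + i * 3)

  layers≤◇residue-class : ∀ r → layers ≤ ◇ (residue-class r)
  layers≤◇residue-class r = ⋁-least layer λ k →
    ≤-trans (layer-reaches (k<r+[1+k]*3 k)) (◇-monotonic (⋁-upper _ (suc k)))
    where
    k<r+[1+k]*3 : ∀ k → k ℕ.< r + suc k * 3
    k<r+[1+k]*3 k = ℕₚ.≤-trans (ℕₚ.m≤m*n (suc k) 3) (ℕₚ.m≤n+m _ r)

  residue-classes-disjoint : ∀ r s → r % 3 ≢ s % 3 → residue-class r ≤ ¬ residue-class s
  residue-classes-disjoint r s r≢s = ⋁-disjoint _ _ λ i j →
    layers-disjoint-≢ λ eq → r≢s (same-residue i j eq)
    where
    same-residue : ∀ i j → r + i * 3 ≡ s + j * 3 → r % 3 ≡ s % 3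
    same-residue i j eq = begin
      r % 3            ≡⟨ [m+kn]%n≡m%n r i 3 ⟨
      (r + i * 3) % 3  ≡⟨ ≡.cong (_% 3) eq ⟩
      (s + j * 3) % 3  ≡⟨ [m+kn]%n≡m%n s j 3 ⟩
      s % 3            ∎
      where open ≡.≡-Reasoning

  layer₀≤⊥ : layer 0 ≤ ⊥
  layer₀≤⊥ = ≤-trans antecedent (≤-trans (A-law a layers s₀ s₁) consequent≤⊥)
    where
    s₀ s₁ s₂ : Carrier
    s₀ = residue-class 0
    s₁ = residue-class 1
    s₂ = residue-class 2

    everywhere : ∀ {x} → x ≈ ⊤ → layer 0 ≤ □ x
    everywhere x≈⊤ = ≈⊤⇒≥ (□-necessitation x≈⊤)

    antecedent : layer 0 ≤ layers ∧ □ a ∧ ¬ □ (□ a) ∧ □ (¬ s₀ ∨ layers) ∧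
      □ (¬ s₁ ∨ layers) ∧ □ (¬ layers ∨ ◇ s₀) ∧ □ (¬ layers ∨ ◇ s₁) ∧ □ (¬ (s₀ ∧ s₁))
    antecedent =
      ∧-greatest (⋁-upper layer 0) (∧-greatest (x∧y≤x _ _) (∧-greatest (x∧y≤y _ _)
      (∧-greatest (everywhere (≤⇒¬∨≈⊤ (residue-class≤layers 0)))
      (∧-greatest (everywhere (≤⇒¬∨≈⊤ (residue-class≤layers 1)))
      (∧-greatest (everywhere (≤⇒¬∨≈⊤ (layers≤◇residue-class 0)))
      (∧-greatest (everywhere (≤⇒¬∨≈⊤ (layers≤◇residue-class 1)))
      (everywhere (trans (deMorgan₁ s₀ s₁) (≤⇒¬∨≈⊤ (residue-classes-disjoint 0 1 λ ()))))))))))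

    s₂≤¬[layers⇒s₀∨s₁] : s₂ ≤ ¬ (¬ layers ∨ (s₀ ∨ s₁))
    s₂≤¬[layers⇒s₀∨s₁] = ≤¬-swap (∨-least (¬-antitone (residue-class≤layers 2))
      (∨-least (residue-classes-disjoint 0 2 λ ()) (residue-classes-disjoint 1 2 λ ())))

    consequent≤⊥ : ◇ (layers ∧ □ (¬ layers ∨ (s₀ ∨ s₁))) ≤ ⊥
    consequent≤⊥ = ◇-strict (≤¬⇒∧≤⊥ (≤-trans (layers≤◇residue-class 2)
      (≤-trans (◇-monotonic s₂≤¬[layers⇒s₀∨s₁]) ◇¬≤¬□)))

  □≤□□ : □ a ≤ □ (□ a)
  □≤□□ = ∧¬≤⊥⇒≤ layer₀≤⊥

lemma1 : ∀ {c ℓ : Level} (𝔄 : BAO c ℓ) → Complete 𝔄 →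
           (∀ φ → L φ → Valid 𝔄 φ) → Valid 𝔄 Ax-F
lemma1 𝔄 complete valid-L v =
  ModalOrder.≤⇒¬∨≈⊤ 𝔄 (Layers.□≤□□ 𝔄 complete valid-L (v 0))
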